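{- For every positive integer $n$ there are vectors $v,w\in E_8$ with $\langle v,v\rangle=\langle w,w\rangle=2n$ and $\langle v,w\rangle=2n-1$.
   Context: $E_8$ denotes the (unique) even unimodular positive definite lattice of rank $8$, with bilinear form $\langle\cdot,\cdot\rangle$. -}

module Defs where

open import Data.Integer using (ℤ; +_; -[1+_]; _+_; _*_)
open import Data.Fin using (Fin)
open import Data.Vec using (Vec; []; _∷_; lookup; tabulate; foldr; zipWith)

Σᵥ : ∀ {n} → Vec ℤ n → ℤ
Σᵥ = foldr _ _+_ (+ 0)

-- Model of E8: the E8 root lattice ℤ⁸ (coordinates w.r.t. the simple roots
-- α₁,…,α₈, Bourbaki labelling: chain 1-3-4-5-6-7-8 with 2 attached to 4),
-- with bilinear form given by the E8 Cartan (Gram) matrix. This is the unique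
-- even unimodular positive definite lattice of rank 8.
E8 : Set
E8 = Vec ℤ 8

private
  m1 : ℤ
  m1 = -[1+ 0 ]
  z : ℤ
  z = + 0
  t : ℤ
  t = + 2

CartanE8 : Vec (Vec ℤ 8) 8
CartanE8 =
    (t  ∷ z  ∷ m1 ∷ z  ∷ z  ∷ z  ∷ z  ∷ z  ∷ []) ∷
    (z  ∷ t  ∷ z  ∷ m1 ∷ z  ∷ z  ∷ z  ∷ z  ∷ []) ∷
    (m1 ∷ z  ∷ t  ∷ m1 ∷ z  ∷ z  ∷ z  ∷ z  ∷ []) ∷
    (z  ∷ m1 ∷ m1 ∷ t  ∷ m1 ∷ z  ∷ z  ∷ z  ∷ []) ∷
    (z  ∷ z  ∷ z  ∷ m1 ∷ t  ∷ m1 ∷ z  ∷ z  ∷ []) ∷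
    (z  ∷ z  ∷ z  ∷ z  ∷ m1 ∷ t  ∷ m1 ∷ z  ∷ []) ∷
    (z  ∷ z  ∷ z  ∷ z  ∷ z  ∷ m1 ∷ t  ∷ m1 ∷ []) ∷
    (z  ∷ z  ∷ z  ∷ z  ∷ z  ∷ z  ∷ m1 ∷ t  ∷ []) ∷ []

⟨_,_⟩ : E8 → E8 → ℤ
⟨ v , w ⟩ = Σᵥ (tabulate λ (i : Fin 8) →
              lookup v i * Σᵥ (tabulate λ (j : Fin 8) →
                lookup (lookup CartanE8 i) j * lookup w j))

{-# OPTIONS --safe #-}
module Submission where

open import Defs
open import Data.Nat using (ℕ; suc) renaming (_*_ to _*ℕ_)
open import Data.Integer using (+_; _-_)
open import Data.Product using (∃₂; _×_)
open import Relation.Binary.PropositionalEquality using (_≡_)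

open import Data.Empty using (⊥-elim)
open import Data.Fin using (Fin; toℕ; splitAt; join; opposite)
import Data.Fin.Properties as Finₚ
open import Data.Integer using (ℤ; -[1+_]; _+_; _*_; ∣_∣; _⊖_; _/ℕ_; _%ℕ_)
open import Data.Integer.DivMod using (n%ℕd<d; a≡a%ℕn+[a/ℕn]*n)
import Data.Integer.Properties as ℤₚ
open import Data.Integer.Solver using (module +-*-Solver)
open import Data.Integer.Tactic.RingSolver using (solve; solve-∀)
open import Data.List using ([]; _∷_)
import Data.Nat as ℕ
open import Data.Nat using (zero; _<_)
open import Data.Nat.DivMod using (_%_; _/_; _mod_; m≡m%n+[m/n]*n; m%n<n)
open import Data.Nat.Divisibility
  using (_∣_; divides; quotient; quotient-<; ∣⇒≤; _HasNonTrivialDivisorLessThan_)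
open import Data.Nat.Induction using (<-rec)
open import Data.Nat.Primality using (Composite; composite; composite?; euclidsLemma; ¬composite⇒prime)
import Data.Nat.Properties as ℕₚ
import Data.Nat.Tactic.RingSolver as ℕ-Solver
open import Data.Product using (Σ-syntax; ∃-syntax; _,_; proj₁; proj₂)
open import Data.Sum using (_⊎_; inj₁; inj₂)
import Data.Vec as Vec
open import Data.Vec using (Vec; lookup; tabulate; foldr; zipWith)
open import Function using (_∘_)
open import Relation.Binary.Definitions using (tri<; tri≈; tri>)
open import Relation.Binary.PropositionalEquality
  using (_≢_; refl; sym; trans; cong; cong₂; subst; module ≡-Reasoning)
open import Relation.Nullary using (contradiction; yes; no)

open +-*-Solver using (Polynomial; con; _:+_; _:*_; _:-_; _:=_) renaming (solve to solve-polynomial)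

-- By Lagrange's four-square theorem n = a² + b² + c² + d².  E8 contains five mutually
-- orthogonal roots ρ₀, …, ρ₄ and a root α with ⟨ρ₀ , α⟩ = 1 and ⟨ρᵢ , α⟩ = 0 for i > 0, so
-- v = ρ₀ + a ρ₁ + b ρ₂ + c ρ₃ + d ρ₄ has norm 2 + 2n and ⟨v , α⟩ = 1; then w = v - α has
-- the same norm and ⟨v , w⟩ = 2(n + 1) - 1.
--
-- The four-square theorem is proved by Lagrange's descent, avoiding primes.  For odd
-- n = 2h + 1, the pigeonhole principle on the residues of a² and -1 - b² (0 ≤ a, b ≤ h)
-- gives either a proper factor of n or a sum of four squares equal to m n with 0 < m < n.
-- Euler's identity then lowers m (after halving if m is even, and after reducing the
-- coordinates to symmetric residues mod m if m is odd) until m = 1, unless it exposes a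
-- proper factor of n.  Proper factors, and even n, are handled by induction on n and
-- Euler's identity again.

sumOfSquares : ℤ → ℤ → ℤ → ℤ → ℤ
sumOfSquares a b c d = (a * a + b * b) + (c * c + d * d)

-- ⟦ sumOfSquaresₚ a b c d ⟧ reduces to sumOfSquares, so the (non-reflective) ring solver
-- can prove identities stated with sumOfSquares, which the reflective one cannot unfold.
sumOfSquaresₚ : ∀ {k} → Polynomial k → Polynomial k → Polynomial k → Polynomial k → Polynomial k
sumOfSquaresₚ a b c d = (a :* a :+ b :* b) :+ (c :* c :+ d :* d)

FourSquares : ℤ → Set
FourSquares n = Σ[ a ∈ ℤ ] Σ[ b ∈ ℤ ] Σ[ c ∈ ℤ ] Σ[ d ∈ ℤ ] sumOfSquares a b c d ≡ n

MultipleBelow : ℕ → ℕ → Set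
MultipleBelow n m = ∃[ r ] (0 < r × r < m × FourSquares (+ r * + n))

euler-four-squares : ∀ a b c d e f g h →
  sumOfSquares a b c d * sumOfSquares e f g h ≡
  sumOfSquares (a * e + b * f + c * g + d * h) (a * f - b * e + c * h - d * g)
               (a * g - b * h - c * e + d * f) (a * h + b * g - c * f - d * e)
euler-four-squares = solve-polynomial 8 (λ a b c d e f g h →
  sumOfSquaresₚ a b c d :* sumOfSquaresₚ e f g h :=
  sumOfSquaresₚ (a :* e :+ b :* f :+ c :* g :+ d :* h) (a :* f :- b :* e :+ c :* h :- d :* g)
                (a :* g :- b :* h :- c :* e :+ d :* f) (a :* h :+ b :* g :- c :* f :- d :* e)) refl

FourSquares-* : ∀ {m n} → FourSquares m → FourSquares n → FourSquares (m * n)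
FourSquares-* (a , b , c , d , refl) (e , f , g , h , refl) =
  a * e + b * f + c * g + d * h , a * f - b * e + c * h - d * g ,
  a * g - b * h - c * e + d * f , a * h + b * g - c * f - d * e ,
  sym (euler-four-squares a b c d e f g h)

data Parityℤ : ℤ → Set where
  even : ∀ a → Parityℤ (+ 2 * a)
  odd  : ∀ a → Parityℤ (+ 1 + + 2 * a)

parityℤ : ∀ x → Parityℤ x
parityℤ x = fromDivision (x /ℕ 2) (x %ℕ 2) (n%ℕd<d x 2) (a≡a%ℕn+[a/ℕn]*n x 2)
  where
  fromDivision : ∀ {z} q r → r ℕ.< 2 → z ≡ + r + q * + 2 → Parityℤ z
  fromDivision q 0 _ refl = subst Parityℤ (trans (ℤₚ.*-comm (+ 2) q) (sym (ℤₚ.+-identityˡ _))) (even q)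
  fromDivision q 1 _ refl = subst Parityℤ (cong (λ z → + 1 + z) (ℤₚ.*-comm (+ 2) q)) (odd q)
  fromDivision q (suc (suc _)) (ℕ.s≤s (ℕ.s≤s ()))

odd≢even : ∀ a b → + 1 + + 2 * a ≢ + 2 * b
odd≢even a b eq = contradiction (ℕₚ.m*n≡1⇒m≡1 2 ∣ b - a ∣ 2∣b-a∣≡1) λ ()
  where
  open ≡-Reasoning
  1≡2[b-a] : + 1 ≡ + 2 * (b - a)
  1≡2[b-a] = begin
    + 1                      ≡⟨ solve (a ∷ []) ⟩
    + 1 + + 2 * a - + 2 * a  ≡⟨ cong (_- + 2 * a) eq ⟩
    + 2 * b - + 2 * a        ≡⟨ solve (a ∷ b ∷ []) ⟩
    + 2 * (b - a)            ∎
  2∣b-a∣≡1 : 2 ℕ.* ∣ b - a ∣ ≡ 1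
  2∣b-a∣≡1 = trans (sym (ℤₚ.abs-* (+ 2) (b - a))) (cong ∣_∣ (sym 1≡2[b-a]))

record SameParity (x y : ℤ) : Set where
  constructor sameParity
  field
    halfDifference : ℤ
    difference     : x ≡ y + + 2 * halfDifference

even-sameParity : ∀ a b → SameParity (+ 2 * a) (+ 2 * b)
even-sameParity a b = sameParity (a - b) (solve (a ∷ b ∷ []))

odd-sameParity : ∀ a b → SameParity (+ 1 + + 2 * a) (+ 1 + + 2 * b)
odd-sameParity a b = sameParity (a - b) (solve (a ∷ b ∷ []))

sameParity-pigeonhole : ∀ x y z → SameParity x y ⊎ SameParity x z ⊎ SameParity y z
sameParity-pigeonhole x y z with parityℤ x | parityℤ y | parityℤ z
... | even a | even b | _      = inj₁ (even-sameParity a b)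
... | odd a  | odd b  | _      = inj₁ (odd-sameParity a b)
... | even a | odd b  | even c = inj₂ (inj₁ (even-sameParity a c))
... | even a | odd b  | odd c  = inj₂ (inj₂ (odd-sameParity b c))
... | odd a  | even b | even c = inj₂ (inj₂ (even-sameParity b c))
... | odd a  | even b | odd c  = inj₂ (inj₁ (odd-sameParity a c))

even²+odd²≢even : ∀ a b t → (+ 2 * a) * (+ 2 * a) + (+ 1 + + 2 * b) * (+ 1 + + 2 * b) ≢ + 2 * t
even²+odd²≢even a b t eq = odd≢even (+ 2 * (a * a + b * b + b)) t (trans (expand a b) eq)
  where
  expand : ∀ a b → + 1 + + 2 * (+ 2 * (a * a + b * b + b)) ≡
                   (+ 2 * a) * (+ 2 * a) + (+ 1 + + 2 * b) * (+ 1 + + 2 * b)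
  expand = solve-∀

sumOfTwoSquares-even⇒sameParity : ∀ x y t → x * x + y * y ≡ + 2 * t → SameParity x y
sumOfTwoSquares-even⇒sameParity x y t eq with parityℤ x | parityℤ y
... | even a | even b = even-sameParity a b
... | odd a  | odd b  = odd-sameParity a b
... | even a | odd b  = ⊥-elim (even²+odd²≢even a b t eq)
... | odd a  | even b = ⊥-elim (even²+odd²≢even b a t
                          (trans (ℤₚ.+-comm ((+ 2 * b) * (+ 2 * b)) ((+ 1 + + 2 * a) * (+ 1 + + 2 * a))) eq))

sameParity⇒sumOfTwoSquares-half : ∀ {x y} → SameParity x y →
  ∃₂ λ u v → x * x + y * y ≡ + 2 * (u * u + v * v)
sameParity⇒sumOfTwoSquares-half {y = y} (sameParity k refl) = y + k , k , solve (y ∷ k ∷ [])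

halve-by-pair : ∀ a b c d {K} → SameParity a b → sumOfSquares a b c d ≡ + 2 * K → FourSquares K
halve-by-pair a b c d {K} ab eq with sameParity⇒sumOfTwoSquares-half ab
... | u , v , ab≡ with sameParity⇒sumOfTwoSquares-half (sumOfTwoSquares-even⇒sameParity c d _ cd≡)
  where
  cd≡ : c * c + d * d ≡ + 2 * (K - (u * u + v * v))
  cd≡ = begin
    c * c + d * d                                        ≡⟨ solve (a ∷ b ∷ c ∷ d ∷ []) ⟩
    (a * a + b * b) + (c * c + d * d) - (a * a + b * b)  ≡⟨ cong₂ _-_ eq ab≡ ⟩
    + 2 * K - + 2 * (u * u + v * v)                      ≡⟨ solve (K ∷ u ∷ v ∷ []) ⟩
    + 2 * (K - (u * u + v * v))                          ∎
    where open ≡-Reasoning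
... | u′ , v′ , cd≡′ = u , v , u′ , v′ , ℤₚ.*-cancelˡ-≡ (+ 2) _ _ (begin
  + 2 * sumOfSquares u v u′ v′                         ≡⟨ ℤₚ.*-distribˡ-+ (+ 2) (u * u + v * v) _ ⟩
  + 2 * (u * u + v * v) + + 2 * (u′ * u′ + v′ * v′)  ≡⟨ cong₂ _+_ ab≡ cd≡′ ⟨
  sumOfSquares a b c d                                ≡⟨ eq ⟩
  + 2 * K                                              ∎)
  where open ≡-Reasoning

sumOfSquares-swap₂₃ : ∀ a b c d → sumOfSquares a c b d ≡ sumOfSquares a b c d
sumOfSquares-swap₂₃ = solve-polynomial 4 (λ a b c d → sumOfSquaresₚ a c b d := sumOfSquaresₚ a b c d) refl

sumOfSquares-rotate₃ : ∀ a b c d → sumOfSquares b c a d ≡ sumOfSquares a b c d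
sumOfSquares-rotate₃ = solve-polynomial 4 (λ a b c d → sumOfSquaresₚ b c a d := sumOfSquaresₚ a b c d) refl

FourSquares-half : ∀ {K} → FourSquares (+ 2 * K) → FourSquares K
FourSquares-half (a , b , c , d , eq) with sameParity-pigeonhole a b c
... | inj₁ ab        = halve-by-pair a b c d ab eq
... | inj₂ (inj₁ ac) = halve-by-pair a c b d ac (trans (sumOfSquares-swap₂₃ a b c d) eq)
... | inj₂ (inj₂ bc) = halve-by-pair b c a d bc (trans (sumOfSquares-rotate₃ a b c d) eq)

i*i≡∣i∣*∣i∣ : ∀ i → i * i ≡ + (∣ i ∣ ℕ.* ∣ i ∣)
i*i≡∣i∣*∣i∣ (+ n)    = sym (ℤₚ.pos-* n n)
i*i≡∣i∣*∣i∣ -[1+ n ] = refl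

sumOfSquaresℕ : ℕ → ℕ → ℕ → ℕ → ℕ
sumOfSquaresℕ a b c d = (a ℕ.* a ℕ.+ b ℕ.* b) ℕ.+ (c ℕ.* c ℕ.+ d ℕ.* d)

sumOfSquares≡∣∣ : ∀ a b c d → sumOfSquares a b c d ≡ + sumOfSquaresℕ (∣ a ∣) (∣ b ∣) (∣ c ∣) (∣ d ∣)
sumOfSquares≡∣∣ a b c d = begin
  (a * a + b * b) + (c * c + d * d)
    ≡⟨ cong₂ _+_ (cong₂ _+_ (i*i≡∣i∣*∣i∣ a) (i*i≡∣i∣*∣i∣ b)) (cong₂ _+_ (i*i≡∣i∣*∣i∣ c) (i*i≡∣i∣*∣i∣ d)) ⟩
  (+ ∣a∣² + + ∣b∣²) + (+ ∣c∣² + + ∣d∣²)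
    ≡⟨ cong₂ _+_ (ℤₚ.pos-+ ∣a∣² ∣b∣²) (ℤₚ.pos-+ ∣c∣² ∣d∣²) ⟨
  + (∣a∣² ℕ.+ ∣b∣²) + + (∣c∣² ℕ.+ ∣d∣²)
    ≡⟨ ℤₚ.pos-+ (∣a∣² ℕ.+ ∣b∣²) _ ⟨
  + sumOfSquaresℕ (∣ a ∣) (∣ b ∣) (∣ c ∣) (∣ d ∣) ∎
  where
  open ≡-Reasoning
  ∣a∣² ∣b∣² ∣c∣² ∣d∣² : ℕ
  ∣a∣² = ∣ a ∣ ℕ.* ∣ a ∣
  ∣b∣² = ∣ b ∣ ℕ.* ∣ b ∣
  ∣c∣² = ∣ c ∣ ℕ.* ∣ c ∣
  ∣d∣² = ∣ d ∣ ℕ.* ∣ d ∣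

sumOfSquares≡0⇒≡0 : ∀ a b c d → sumOfSquares a b c d ≡ + 0 →
                     a ≡ + 0 × b ≡ + 0 × c ≡ + 0 × d ≡ + 0
sumOfSquares≡0⇒≡0 a b c d eq =
  square≡0 a (ℕₚ.m+n≡0⇒m≡0 _ ab≡0) , square≡0 b (ℕₚ.m+n≡0⇒n≡0 (∣ a ∣ ℕ.* ∣ a ∣) ab≡0) ,
  square≡0 c (ℕₚ.m+n≡0⇒m≡0 _ cd≡0) , square≡0 d (ℕₚ.m+n≡0⇒n≡0 (∣ c ∣ ℕ.* ∣ c ∣) cd≡0)
  where
  U≡0 : sumOfSquaresℕ (∣ a ∣) (∣ b ∣) (∣ c ∣) (∣ d ∣) ≡ 0
  U≡0 = ℤₚ.+-injective (trans (sym (sumOfSquares≡∣∣ a b c d)) eq)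
  ab≡0 : ∣ a ∣ ℕ.* ∣ a ∣ ℕ.+ ∣ b ∣ ℕ.* ∣ b ∣ ≡ 0
  ab≡0 = ℕₚ.m+n≡0⇒m≡0 _ U≡0
  cd≡0 : ∣ c ∣ ℕ.* ∣ c ∣ ℕ.+ ∣ d ∣ ℕ.* ∣ d ∣ ≡ 0
  cd≡0 = ℕₚ.m+n≡0⇒n≡0 (∣ a ∣ ℕ.* ∣ a ∣ ℕ.+ ∣ b ∣ ℕ.* ∣ b ∣) U≡0
  square≡0 : ∀ i → ∣ i ∣ ℕ.* ∣ i ∣ ≡ 0 → i ≡ + 0
  square≡0 i eq with ℕₚ.m*n≡0⇒m≡0∨n≡0 ∣ i ∣ eq
  ... | inj₁ ∣i∣≡0 = ℤₚ.∣i∣≡0⇒i≡0 ∣i∣≡0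
  ... | inj₂ ∣i∣≡0 = ℤₚ.∣i∣≡0⇒i≡0 ∣i∣≡0

sumOfSquaresℕ-bound : ∀ {k a b c d} → a ℕ.≤ k → b ℕ.≤ k → c ℕ.≤ k → d ℕ.≤ k →
                      sumOfSquaresℕ a b c d < suc (k ℕ.+ k) ℕ.* suc (k ℕ.+ k)
sumOfSquaresℕ-bound {k} a≤k b≤k c≤k d≤k =
  ℕₚ.≤-<-trans (ℕₚ.+-mono-≤ (ℕₚ.+-mono-≤ (square-≤ a≤k) (square-≤ b≤k))
                            (ℕₚ.+-mono-≤ (square-≤ c≤k) (square-≤ d≤k)))
               (subst (sumOfSquaresℕ k k k k <_) (expand k)
                      (ℕ.s≤s (ℕₚ.m≤m+n (sumOfSquaresℕ k k k k) (4 ℕ.* k))))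
  where
  square-≤ : ∀ {i} → i ℕ.≤ k → i ℕ.* i ℕ.≤ k ℕ.* k
  square-≤ i≤k = ℕₚ.*-mono-≤ i≤k i≤k
  expand : ∀ k → suc ((k ℕ.* k ℕ.+ k ℕ.* k) ℕ.+ (k ℕ.* k ℕ.+ k ℕ.* k) ℕ.+ 4 ℕ.* k) ≡
                 suc (k ℕ.+ k) ℕ.* suc (k ℕ.+ k)
  expand = ℕ-Solver.solve-∀

∣m⊖n∣≤n : ∀ {m n} → m ℕ.≤ n ℕ.+ n → ∣ m ⊖ n ∣ ℕ.≤ n
∣m⊖n∣≤n {m} {n} m≤2n with m ℕ.≤? n
... | yes m≤n rewrite ℤₚ.⊖-≤ m≤n | ℤₚ.∣-i∣≡∣i∣ (+ (n ℕ.∸ m)) = ℕₚ.m∸n≤m n m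
... | no  m≰n rewrite ℤₚ.⊖-≥ (ℕₚ.<⇒≤ (ℕₚ.≰⇒> m≰n)) = ℕₚ.m≤n+o⇒m∸n≤o m n m≤2n

data SymmetricResidue (k : ℕ) : ℤ → Set where
  residue : ∀ y q → ∣ y ∣ ℕ.≤ k → SymmetricResidue k (y + + suc (k ℕ.+ k) * q)

symmetricResidue : ∀ k x → SymmetricResidue k x
symmetricResidue k x =
  fromDivision ((x + + k) /ℕ m) ((x + + k) %ℕ m) (n%ℕd<d (x + + k) m) (a≡a%ℕn+[a/ℕn]*n (x + + k) m)
  where
  m : ℕ
  m = suc (k ℕ.+ k)
  regroup : ∀ t k q M → (t - k) + M * q ≡ (t + q * M) - k
  regroup = solve-∀
  cancel : ∀ x k → x + k - k ≡ x
  cancel = solve-∀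
  fromDivision : ∀ q t → t ℕ.< m → x + + k ≡ + t + q * + m → SymmetricResidue k x
  fromDivision q t t<m eq = subst (SymmetricResidue k) x≡ (residue (+ t - + k) q ∣t-k∣≤k)
    where
    x≡ : (+ t - + k) + + m * q ≡ x
    x≡ = trans (regroup (+ t) (+ k) q (+ m)) (trans (cong (_- + k) (sym eq)) (cancel x (+ k)))
    ∣t-k∣≤k : ∣ + t - + k ∣ ℕ.≤ k
    ∣t-k∣≤k = subst (λ z → ∣ z ∣ ℕ.≤ k) (sym (ℤₚ.m-n≡m⊖n t k)) (∣m⊖n∣≤n (ℕₚ.≤-pred t<m))

sumOfSquares-scale : ∀ M a b c d → sumOfSquares (M * a) (M * b) (M * c) (M * d) ≡ M * (M * sumOfSquares a b c d)
sumOfSquares-scale = solve-polynomial 5 (λ M a b c d →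
  sumOfSquaresₚ (M :* a) (M :* b) (M :* c) (M :* d) := M :* (M :* sumOfSquaresₚ a b c d)) refl

sumOfSquares-shift : ∀ M y₁ y₂ y₃ y₄ q₁ q₂ q₃ q₄ → ∃[ T ]
  sumOfSquares (y₁ + M * q₁) (y₂ + M * q₂) (y₃ + M * q₃) (y₄ + M * q₄) ≡ sumOfSquares y₁ y₂ y₃ y₄ + M * T
sumOfSquares-shift M y₁ y₂ y₃ y₄ q₁ q₂ q₃ q₄ = _ , expand M y₁ y₂ y₃ y₄ q₁ q₂ q₃ q₄
  where
  expand : ∀ M y₁ y₂ y₃ y₄ q₁ q₂ q₃ q₄ →
    sumOfSquares (y₁ + M * q₁) (y₂ + M * q₂) (y₃ + M * q₃) (y₄ + M * q₄) ≡
    sumOfSquares y₁ y₂ y₃ y₄ + M * ((+ 2 * y₁ + M * q₁) * q₁ + (+ 2 * y₂ + M * q₂) * q₂ +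
                                    (+ 2 * y₃ + M * q₃) * q₃ + (+ 2 * y₄ + M * q₄) * q₄)
  expand = solve-polynomial 9 (λ M y₁ y₂ y₃ y₄ q₁ q₂ q₃ q₄ →
    sumOfSquaresₚ (y₁ :+ M :* q₁) (y₂ :+ M :* q₂) (y₃ :+ M :* q₃) (y₄ :+ M :* q₄) :=
    sumOfSquaresₚ y₁ y₂ y₃ y₄ :+ M :* ((con (+ 2) :* y₁ :+ M :* q₁) :* q₁ :+
                                       (con (+ 2) :* y₂ :+ M :* q₂) :* q₂ :+
                                       (con (+ 2) :* y₃ :+ M :* q₃) :* q₃ :+
                                       (con (+ 2) :* y₄ :+ M :* q₄) :* q₄)) refl

euler-four-squares-shifted : ∀ M y₁ y₂ y₃ y₄ q₁ q₂ q₃ q₄ →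
  sumOfSquares (y₁ + M * q₁) (y₂ + M * q₂) (y₃ + M * q₃) (y₄ + M * q₄) * sumOfSquares y₁ y₂ y₃ y₄ ≡
  sumOfSquares (sumOfSquares y₁ y₂ y₃ y₄ + M * (q₁ * y₁ + q₂ * y₂ + q₃ * y₃ + q₄ * y₄))
               (M * (q₁ * y₂ - q₂ * y₁ + q₃ * y₄ - q₄ * y₃))
               (M * (q₁ * y₃ - q₂ * y₄ - q₃ * y₁ + q₄ * y₂))
               (M * (q₁ * y₄ + q₂ * y₃ - q₃ * y₂ - q₄ * y₁))
euler-four-squares-shifted = solve-polynomial 9 (λ M y₁ y₂ y₃ y₄ q₁ q₂ q₃ q₄ →
  sumOfSquaresₚ (y₁ :+ M :* q₁) (y₂ :+ M :* q₂) (y₃ :+ M :* q₃) (y₄ :+ M :* q₄) :* sumOfSquaresₚ y₁ y₂ y₃ y₄ :=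
  sumOfSquaresₚ (sumOfSquaresₚ y₁ y₂ y₃ y₄ :+ M :* (q₁ :* y₁ :+ q₂ :* y₂ :+ q₃ :* y₃ :+ q₄ :* y₄))
                (M :* (q₁ :* y₂ :- q₂ :* y₁ :+ q₃ :* y₄ :- q₄ :* y₃))
                (M :* (q₁ :* y₃ :- q₂ :* y₄ :- q₃ :* y₁ :+ q₄ :* y₂))
                (M :* (q₁ :* y₄ :+ q₂ :* y₃ :- q₃ :* y₂ :- q₄ :* y₁))) refl

euler-descent : ∀ {m n r} .{{_ : ℕ.NonZero m}} y₁ y₂ y₃ y₄ q₁ q₂ q₃ q₄ →
  sumOfSquares y₁ y₂ y₃ y₄ ≡ + m * + r →
  sumOfSquares (y₁ + + m * q₁) (y₂ + + m * q₂) (y₃ + + m * q₃) (y₄ + + m * q₄) ≡ + m * + n →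
  FourSquares (+ r * + n)
euler-descent {m} {n} {r} y₁ y₂ y₃ y₄ q₁ q₂ q₃ q₄ S[y]≡mr S[x]≡mn =
  w₁ , w₂ , w₃ , w₄ , ℤₚ.*-cancelˡ-≡ M _ _ (ℤₚ.*-cancelˡ-≡ M _ _ M²S[w]≡M²rn)
  where
  open ≡-Reasoning
  M P w₁ w₂ w₃ w₄ : ℤ
  M = + m
  P = q₁ * y₁ + q₂ * y₂ + q₃ * y₃ + q₄ * y₄
  w₁ = + r + P
  w₂ = q₁ * y₂ - q₂ * y₁ + q₃ * y₄ - q₄ * y₃
  w₃ = q₁ * y₃ - q₂ * y₄ - q₃ * y₁ + q₄ * y₂
  w₄ = q₁ * y₄ + q₂ * y₃ - q₃ * y₂ - q₄ * y₁
  Mw₁≡ : M * w₁ ≡ sumOfSquares y₁ y₂ y₃ y₄ + M * P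
  Mw₁≡ = trans (ℤₚ.*-distribˡ-+ M (+ r) P) (cong (_+ M * P) (sym S[y]≡mr))
  M²S[w]≡M²rn : M * (M * sumOfSquares w₁ w₂ w₃ w₄) ≡ M * (M * (+ r * + n))
  M²S[w]≡M²rn = begin
    M * (M * sumOfSquares w₁ w₂ w₃ w₄)
      ≡⟨ sumOfSquares-scale M w₁ w₂ w₃ w₄ ⟨
    sumOfSquares (M * w₁) (M * w₂) (M * w₃) (M * w₄)
      ≡⟨ cong (λ z → sumOfSquares z (M * w₂) (M * w₃) (M * w₄)) Mw₁≡ ⟩
    sumOfSquares (sumOfSquares y₁ y₂ y₃ y₄ + M * P) (M * w₂) (M * w₃) (M * w₄)
      ≡⟨ euler-four-squares-shifted M y₁ y₂ y₃ y₄ q₁ q₂ q₃ q₄ ⟨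
    sumOfSquares (y₁ + M * q₁) (y₂ + M * q₂) (y₃ + M * q₃) (y₄ + M * q₄) * sumOfSquares y₁ y₂ y₃ y₄
      ≡⟨ cong₂ _*_ S[x]≡mn S[y]≡mr ⟩
    (M * + n) * (M * + r)
      ≡⟨ rearrange M (+ n) (+ r) ⟩
    M * (M * (+ r * + n)) ∎
    where
    rearrange : ∀ M N R → (M * N) * (M * R) ≡ M * (M * (R * N))
    rearrange = solve-∀

sumOfSquares-multiples : ∀ {m n} .{{_ : ℕ.NonZero m}} q₁ q₂ q₃ q₄ →
  sumOfSquares (+ m * q₁) (+ m * q₂) (+ m * q₃) (+ m * q₄) ≡ + m * + n → m ∣ n
sumOfSquares-multiples {m} {n} q₁ q₂ q₃ q₄ eq = divides s (ℤₚ.+-injective (begin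
  + n
    ≡⟨ ℤₚ.*-cancelˡ-≡ (+ m) _ _ (trans (sym eq) (sumOfSquares-scale (+ m) q₁ q₂ q₃ q₄)) ⟩
  + m * sumOfSquares q₁ q₂ q₃ q₄ ≡⟨ cong (+ m *_) (sumOfSquares≡∣∣ q₁ q₂ q₃ q₄) ⟩
  + m * + s                   ≡⟨ ℤₚ.pos-* m s ⟨
  + (m ℕ.* s)                 ≡⟨ cong +_ (ℕₚ.*-comm m s) ⟩
  + (s ℕ.* m)                 ∎))
  where
  open ≡-Reasoning
  s : ℕ
  s = sumOfSquaresℕ (∣ q₁ ∣) (∣ q₂ ∣) (∣ q₃ ∣) (∣ q₄ ∣)

sumOfSquares-cong : ∀ {a b c d a′ b′ c′ d′} → a ≡ a′ → b ≡ b′ → c ≡ c′ → d ≡ d′ →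
                    sumOfSquares a b c d ≡ sumOfSquares a′ b′ c′ d′
sumOfSquares-cong refl refl refl refl = refl

zeroResidues⇒∣ : ∀ {m n} .{{_ : ℕ.NonZero m}} y₁ y₂ y₃ y₄ q₁ q₂ q₃ q₄ → sumOfSquares y₁ y₂ y₃ y₄ ≡ + 0 →
  sumOfSquares (y₁ + + m * q₁) (y₂ + + m * q₂) (y₃ + + m * q₃) (y₄ + + m * q₄) ≡ + m * + n → m ∣ n
zeroResidues⇒∣ {m} y₁ y₂ y₃ y₄ q₁ q₂ q₃ q₄ S[y]≡0 eq with sumOfSquares≡0⇒≡0 y₁ y₂ y₃ y₄ S[y]≡0
... | refl , refl , refl , refl = sumOfSquares-multiples q₁ q₂ q₃ q₄ (trans (sym (sumOfSquares-cong
        (ℤₚ.+-identityˡ (+ m * q₁)) (ℤₚ.+-identityˡ (+ m * q₂))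
        (ℤₚ.+-identityˡ (+ m * q₃)) (ℤₚ.+-identityˡ (+ m * q₄)))) eq)

small-quotient : ∀ m {U} R → + suc m * R ≡ + U → U < suc m ℕ.* suc m →
                 ∃[ r ] (r < suc m × + U ≡ + suc m * + r)
small-quotient m (+ r) eq U<m² =
  r , ℕₚ.*-cancelˡ-< (suc m) r (suc m) (subst (_< suc m ℕ.* suc m) (sym m*r≡U) U<m²) , sym eq
  where
  m*r≡U : suc m ℕ.* r ≡ _
  m*r≡U = ℤₚ.+-injective (trans (ℤₚ.pos-* (suc m) r) eq)

s+MT≡MN⇒s≡M[N-T] : ∀ s M T N → s + M * T ≡ M * N → s ≡ M * (N - T)
s+MT≡MN⇒s≡M[N-T] s M T N eq = begin
  s                  ≡⟨ solve (s ∷ M ∷ T ∷ []) ⟩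
  s + M * T - M * T  ≡⟨ cong (_- M * T) eq ⟩
  M * N - M * T      ≡⟨ solve (M ∷ T ∷ N ∷ []) ⟩
  M * (N - T)        ∎
  where open ≡-Reasoning

odd-descent-step : ∀ {n} k → 0 < k → suc (k ℕ.+ k) < n → FourSquares (+ suc (k ℕ.+ k) * + n) →
                   Composite n ⊎ MultipleBelow n (suc (k ℕ.+ k))
odd-descent-step {n} k 0<k m<n (x₁ , x₂ , x₃ , x₄ , S[x]≡mn)
  with symmetricResidue k x₁ | symmetricResidue k x₂ | symmetricResidue k x₃ | symmetricResidue k x₄
... | residue y₁ q₁ ∣y₁∣≤k | residue y₂ q₂ ∣y₂∣≤k | residue y₃ q₃ ∣y₃∣≤k | residue y₄ q₄ ∣y₄∣≤k =
  byQuotient (small-quotient (k ℕ.+ k) (+ n - T) (trans (sym S[y]≡m[n-T]) S[y]≡U) U<m²)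
  where
  m : ℕ
  m = suc (k ℕ.+ k)
  instance
    m-nonTrivial : ℕ.NonTrivial m
    m-nonTrivial = ℕ.n>1⇒nonTrivial (ℕ.s≤s (ℕₚ.≤-trans 0<k (ℕₚ.m≤m+n k k)))
  T : ℤ
  T = proj₁ (sumOfSquares-shift (+ m) y₁ y₂ y₃ y₄ q₁ q₂ q₃ q₄)
  S[y]≡m[n-T] : sumOfSquares y₁ y₂ y₃ y₄ ≡ + m * (+ n - T)
  S[y]≡m[n-T] = s+MT≡MN⇒s≡M[N-T] (sumOfSquares y₁ y₂ y₃ y₄) (+ m) T (+ n)
    (trans (sym (proj₂ (sumOfSquares-shift (+ m) y₁ y₂ y₃ y₄ q₁ q₂ q₃ q₄))) S[x]≡mn)
  U : ℕ
  U = sumOfSquaresℕ (∣ y₁ ∣) (∣ y₂ ∣) (∣ y₃ ∣) (∣ y₄ ∣)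
  S[y]≡U : sumOfSquares y₁ y₂ y₃ y₄ ≡ + U
  S[y]≡U = sumOfSquares≡∣∣ y₁ y₂ y₃ y₄
  U<m² : U < m ℕ.* m
  U<m² = sumOfSquaresℕ-bound ∣y₁∣≤k ∣y₂∣≤k ∣y₃∣≤k ∣y₄∣≤k
  byQuotient : ∃[ r ] (r < m × + U ≡ + m * + r) → Composite n ⊎ MultipleBelow n m
  byQuotient (zero , _ , U≡0) = inj₁ (composite m<n (zeroResidues⇒∣ {m} {n} y₁ y₂ y₃ y₄ q₁ q₂ q₃ q₄
    (trans S[y]≡U (trans U≡0 (ℤₚ.*-zeroʳ (+ m)))) S[x]≡mn))
  byQuotient (suc r , r<m , U≡mr) =
    inj₂ (suc r , ℕ.s≤s ℕ.z≤n , r<m ,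
          euler-descent {m} {n} {suc r} y₁ y₂ y₃ y₄ q₁ q₂ q₃ q₄ (trans S[y]≡U U≡mr) S[x]≡mn)

data Parityℕ : ℕ → Set where
  even : ∀ j → Parityℕ (j ℕ.+ j)
  odd  : ∀ j → Parityℕ (suc (j ℕ.+ j))

parityℕ : ∀ n → Parityℕ n
parityℕ zero = even 0
parityℕ (suc n) with parityℕ n
... | even j = odd j
... | odd j  = subst Parityℕ (cong suc (ℕₚ.+-suc j j)) (even (suc j))

+[j+j]≡+2*+j : ∀ j → + (j ℕ.+ j) ≡ + 2 * + j
+[j+j]≡+2*+j j = trans (ℤₚ.pos-+ j j) (double (+ j))
  where
  double : ∀ a → a + a ≡ + 2 * a
  double = solve-∀

descent : ∀ {n} m → 0 < m → m < n → FourSquares (+ m * + n) → Composite n ⊎ FourSquares (+ n)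
descent {n} = <-rec _ step
  where
  step : ∀ m → (∀ {r} → r < m → 0 < r → r < n → FourSquares (+ r * + n) → Composite n ⊎ FourSquares (+ n)) →
         0 < m → m < n → FourSquares (+ m * + n) → Composite n ⊎ FourSquares (+ n)
  +[j+j]*N≡+2*[+j*N] : ∀ j → + (j ℕ.+ j) * + n ≡ + 2 * (+ j * + n)
  +[j+j]*N≡+2*[+j*N] j = trans (cong (_* + n) (+[j+j]≡+2*+j j)) (ℤₚ.*-assoc (+ 2) (+ j) (+ n))
  step m rec 0<m m<n rep with parityℕ m
  ... | even (suc j) = rec j<m (ℕ.s≤s ℕ.z≤n) (ℕₚ.<-trans j<m m<n)
                           (FourSquares-half (subst FourSquares (+[j+j]*N≡+2*[+j*N] (suc j)) rep))
    where
    j<m : suc j < suc j ℕ.+ suc j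
    j<m = ℕₚ.m<m+n (suc j) (ℕ.s≤s ℕ.z≤n)
  ... | odd zero     = inj₂ (subst FourSquares (ℤₚ.*-identityˡ (+ n)) rep)
  ... | odd (suc k)  with odd-descent-step (suc k) (ℕ.s≤s ℕ.z≤n) m<n rep
  ...   | inj₁ composite-n = inj₁ composite-n
  ...   | inj₂ (r , 0<r , r<m , rep′) = rec r<m 0<r (ℕₚ.<-trans r<m m<n) rep′

∣product⇒composite : ∀ {n u v} .{{_ : ℕ.NonTrivial n}} → n ∣ u ℕ.* v →
                     0 < u → u < n → 0 < v → v < n → Composite n
∣product⇒composite {n} {u} {v} n∣uv 0<u u<n 0<v v<n with composite? n
... | yes composite-n = composite-n
... | no ¬composite-n with euclidsLemma u v (¬composite⇒prime ¬composite-n) n∣uv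
...   | inj₁ n∣u = contradiction (∣⇒≤ {{ℕ.>-nonZero 0<u}} n∣u) (ℕₚ.<⇒≱ u<n)
...   | inj₂ n∣v = contradiction (∣⇒≤ {{ℕ.>-nonZero 0<v}} n∣v) (ℕₚ.<⇒≱ v<n)

%≡%⇒∣∸ : ∀ a b n .{{_ : ℕ.NonZero n}} → a % n ≡ b % n → n ∣ b ℕ.∸ a
%≡%⇒∣∸ a b n eq = divides (b / n ℕ.∸ a / n) (begin
  b ℕ.∸ a
    ≡⟨ cong₂ ℕ._∸_ (m≡m%n+[m/n]*n b n) (m≡m%n+[m/n]*n a n) ⟩
  (b % n ℕ.+ b / n ℕ.* n) ℕ.∸ (a % n ℕ.+ a / n ℕ.* n)
    ≡⟨ cong (λ r → (r ℕ.+ b / n ℕ.* n) ℕ.∸ (a % n ℕ.+ a / n ℕ.* n)) eq ⟨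
  (a % n ℕ.+ b / n ℕ.* n) ℕ.∸ (a % n ℕ.+ a / n ℕ.* n)
    ≡⟨ ℕₚ.[m+n]∸[m+o]≡n∸o (a % n) _ _ ⟩
  b / n ℕ.* n ℕ.∸ a / n ℕ.* n
    ≡⟨ ℕₚ.*-distribʳ-∸ n (b / n) (a / n) ⟨
  (b / n ℕ.∸ a / n) ℕ.* n ∎)
  where open ≡-Reasoning

b²∸a²≡[b∸a]*[b+a] : ∀ {a b} → a ℕ.≤ b → b ℕ.* b ℕ.∸ a ℕ.* a ≡ (b ℕ.∸ a) ℕ.* (b ℕ.+ a)
b²∸a²≡[b∸a]*[b+a] {a} a≤b with ℕₚ.m≤n⇒∃[o]m+o≡n a≤b
... | c , refl = begin
  (a ℕ.+ c) ℕ.* (a ℕ.+ c) ℕ.∸ a ℕ.* a               ≡⟨ cong (ℕ._∸ a ℕ.* a) (expand a c) ⟩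
  a ℕ.* a ℕ.+ c ℕ.* (a ℕ.+ c ℕ.+ a) ℕ.∸ a ℕ.* a     ≡⟨ ℕₚ.m+n∸m≡n (a ℕ.* a) _ ⟩
  c ℕ.* (a ℕ.+ c ℕ.+ a)                             ≡⟨ cong (ℕ._* (a ℕ.+ c ℕ.+ a)) (ℕₚ.m+n∸m≡n a c) ⟨
  (a ℕ.+ c ℕ.∸ a) ℕ.* (a ℕ.+ c ℕ.+ a)               ∎
  where
  open ≡-Reasoning
  expand : ∀ a c → (a ℕ.+ c) ℕ.* (a ℕ.+ c) ≡ a ℕ.* a ℕ.+ c ℕ.* (a ℕ.+ c ℕ.+ a)
  expand = ℕ-Solver.solve-∀

squares≡⇒composite : ∀ {n a b} .{{_ : ℕ.NonZero n}} .{{_ : ℕ.NonTrivial n}} → a < b → b ℕ.+ a < n →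
                     a ℕ.* a % n ≡ b ℕ.* b % n → Composite n
squares≡⇒composite {n} {a} {b} a<b b+a<n eq = ∣product⇒composite n∣[b∸a][b+a]
  (ℕₚ.m<n⇒0<n∸m a<b) (ℕₚ.≤-<-trans (ℕₚ.m∸n≤m b a) (ℕₚ.≤-<-trans (ℕₚ.m≤m+n b a) b+a<n))
  (ℕₚ.<-≤-trans (ℕₚ.m<n⇒0<n a<b) (ℕₚ.m≤m+n b a)) b+a<n
  where
  n∣[b∸a][b+a] : n ∣ (b ℕ.∸ a) ℕ.* (b ℕ.+ a)
  n∣[b∸a][b+a] = subst (n ∣_) (b²∸a²≡[b∸a]*[b+a] (ℕₚ.<⇒≤ a<b)) (%≡%⇒∣∸ (a ℕ.* a) (b ℕ.* b) n eq)

module _ {h : ℕ} (0<h : 0 < h) where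
  private
    n : ℕ
    n = suc (h ℕ.+ h)
    instance
      n-nonTrivial : ℕ.NonTrivial n
      n-nonTrivial = ℕ.n>1⇒nonTrivial (ℕ.s≤s (ℕₚ.≤-trans 0<h (ℕₚ.m≤m+n h h)))

  [2h²+1]<[2h+1]² : (h ℕ.* h ℕ.+ h ℕ.* h) ℕ.+ 1 < n ℕ.* n
  [2h²+1]<[2h+1]² = subst ((h ℕ.* h ℕ.+ h ℕ.* h) ℕ.+ 1 <_) (expand h)
    (ℕₚ.m<m+n _ (ℕₚ.<-≤-trans 0<h (ℕₚ.m≤n+m h _)))
    where
    expand : ∀ h → (h ℕ.* h ℕ.+ h ℕ.* h ℕ.+ 1) ℕ.+ (h ℕ.* h ℕ.+ h ℕ.* h ℕ.+ 3 ℕ.* h ℕ.+ h) ≡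
                   suc (h ℕ.+ h) ℕ.* suc (h ℕ.+ h)
    expand = ℕ-Solver.solve-∀

  a²+b²+1≡0⇒smallMultiple : ∀ {a b} → a ℕ.≤ h → b ℕ.≤ h → a ℕ.* a % n ≡ n ℕ.∸ suc (b ℕ.* b % n) →
                           MultipleBelow n n
  a²+b²+1≡0⇒smallMultiple {a} {b} a≤h b≤h eq = m , ℕ.s≤s ℕ.z≤n , m<n , + a , + b , + 1 , + 0 ,
    trans (sumOfSquares≡∣∣ (+ a) (+ b) (+ 1) (+ 0)) (trans (cong +_ a²+b²+1≡mn) (ℤₚ.pos-* m n))
    where
    open ≡-Reasoning
    m = suc (a ℕ.* a / n ℕ.+ b ℕ.* b / n)
    regroup : ∀ rA qA rB qB n → (rA ℕ.+ qA ℕ.* n) ℕ.+ (rB ℕ.+ qB ℕ.* n) ℕ.+ 1 ≡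
                                (rA ℕ.+ suc rB) ℕ.+ (qA ℕ.+ qB) ℕ.* n
    regroup = ℕ-Solver.solve-∀
    residues-sum : a ℕ.* a % n ℕ.+ suc (b ℕ.* b % n) ≡ n
    residues-sum = trans (cong (ℕ._+ suc (b ℕ.* b % n)) eq) (ℕₚ.m∸n+n≡m (m%n<n (b ℕ.* b) n))
    a²+b²+1≡mn : a ℕ.* a ℕ.+ b ℕ.* b ℕ.+ 1 ≡ m ℕ.* n
    a²+b²+1≡mn = begin
      a ℕ.* a ℕ.+ b ℕ.* b ℕ.+ 1
        ≡⟨ cong₂ (λ A B → A ℕ.+ B ℕ.+ 1) (m≡m%n+[m/n]*n (a ℕ.* a) n) (m≡m%n+[m/n]*n (b ℕ.* b) n) ⟩
      (a ℕ.* a % n ℕ.+ a ℕ.* a / n ℕ.* n) ℕ.+ (b ℕ.* b % n ℕ.+ b ℕ.* b / n ℕ.* n) ℕ.+ 1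
        ≡⟨ regroup (a ℕ.* a % n) (a ℕ.* a / n) (b ℕ.* b % n) (b ℕ.* b / n) n ⟩
      (a ℕ.* a % n ℕ.+ suc (b ℕ.* b % n)) ℕ.+ (a ℕ.* a / n ℕ.+ b ℕ.* b / n) ℕ.* n
        ≡⟨ cong (ℕ._+ (a ℕ.* a / n ℕ.+ b ℕ.* b / n) ℕ.* n) residues-sum ⟩
      m ℕ.* n ∎
    m<n : m < n
    m<n = ℕₚ.*-cancelʳ-< n m n (subst (_< n ℕ.* n) a²+b²+1≡mn (ℕₚ.≤-<-trans
            (ℕₚ.+-monoˡ-≤ 1 (ℕₚ.+-mono-≤ (ℕₚ.*-mono-≤ a≤h a≤h) (ℕₚ.*-mono-≤ b≤h b≤h))) [2h²+1]<[2h+1]²))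

  private
    n<[h+1]+[h+1] : n < suc h ℕ.+ suc h
    n<[h+1]+[h+1] = ℕ.s≤s (ℕₚ.+-monoʳ-< h (ℕₚ.n<1+n h))

    square%n : Fin (suc h) → Fin n
    square%n a = (toℕ a ℕ.* toℕ a) mod n

    -- opposite i = n ∸ 1 ∸ i, so the values are a² and -1 - b² modulo n
    squareResidue : Fin (suc h) ⊎ Fin (suc h) → Fin n
    squareResidue (inj₁ a) = square%n a
    squareResidue (inj₂ b) = opposite (square%n b)

    toℕ-square%n : ∀ a → toℕ (square%n a) ≡ toℕ a ℕ.* toℕ a % n
    toℕ-square%n a = Finₚ.toℕ-fromℕ< _

    b+a<n : ∀ (b a : Fin (suc h)) → toℕ b ℕ.+ toℕ a < n
    b+a<n b a = ℕ.s≤s (ℕₚ.+-mono-≤ (Finₚ.toℕ≤pred[n] b) (Finₚ.toℕ≤pred[n] a))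

    toℕ-square%n≡ : ∀ (a b : Fin (suc h)) → square%n a ≡ square%n b → toℕ a ℕ.* toℕ a % n ≡ toℕ b ℕ.* toℕ b % n
    toℕ-square%n≡ a b e = trans (sym (toℕ-square%n a)) (trans (cong toℕ e) (toℕ-square%n b))

    sameSquareResidue⇒composite : ∀ a b → a ≢ b → square%n a ≡ square%n b → Composite n
    sameSquareResidue⇒composite a b a≢b e with ℕₚ.<-cmp (toℕ a) (toℕ b)
    ... | tri< a<b _ _ = squares≡⇒composite a<b (b+a<n b a) (toℕ-square%n≡ a b e)
    ... | tri≈ _ a≡b _ = contradiction (Finₚ.toℕ-injective a≡b) a≢b
    ... | tri> _ _ b<a = squares≡⇒composite b<a (b+a<n a b) (toℕ-square%n≡ b a (sym e))

    oppositeResidues⇒smallMultiple : ∀ a b → square%n a ≡ opposite (square%n b) → MultipleBelow n n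
    oppositeResidues⇒smallMultiple a b e =
      a²+b²+1≡0⇒smallMultiple (Finₚ.toℕ≤pred[n] a) (Finₚ.toℕ≤pred[n] b) (begin
      toℕ a ℕ.* toℕ a % n                ≡⟨ toℕ-square%n a ⟨
      toℕ (square%n a)                   ≡⟨ cong toℕ e ⟩
      toℕ (opposite (square%n b))        ≡⟨ Finₚ.opposite-prop (square%n b) ⟩
      n ℕ.∸ suc (toℕ (square%n b))       ≡⟨ cong (λ r → n ℕ.∸ suc r) (toℕ-square%n b) ⟩
      n ℕ.∸ suc (toℕ b ℕ.* toℕ b % n)    ∎)
      where open ≡-Reasoning

    classify : ∀ s t → s ≢ t → squareResidue s ≡ squareResidue t → Composite n ⊎ MultipleBelow n n
    classify (inj₁ a) (inj₁ b) s≢t e = inj₁ (sameSquareResidue⇒composite a b (λ a≡b → s≢t (cong inj₁ a≡b)) e)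
    classify (inj₂ a) (inj₂ b) s≢t e =
      inj₁ (sameSquareResidue⇒composite a b (λ a≡b → s≢t (cong inj₂ a≡b)) (opposite-injective e))
      where
      opposite-injective : ∀ {i j : Fin n} → opposite i ≡ opposite j → i ≡ j
      opposite-injective {i} {j} e =
        trans (sym (Finₚ.opposite-involutive i)) (trans (cong opposite e) (Finₚ.opposite-involutive j))
    classify (inj₁ a) (inj₂ b) _ e = inj₂ (oppositeResidues⇒smallMultiple a b e)
    classify (inj₂ b) (inj₁ a) _ e = inj₂ (oppositeResidues⇒smallMultiple a b (sym e))

  smallMultiple : Composite n ⊎ MultipleBelow n n
  smallMultiple with Finₚ.pigeonhole n<[h+1]+[h+1] (squareResidue ∘ splitAt (suc h))
  ... | i , j , i<j , eq = classify (splitAt (suc h) i) (splitAt (suc h) j) splitAt-distinct eq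
    where
    splitAt-distinct : splitAt (suc h) i ≢ splitAt (suc h) j
    splitAt-distinct e = Finₚ.<⇒≢ i<j (trans (sym (Finₚ.join-splitAt (suc h) (suc h) i))
                           (trans (cong (join (suc h) (suc h)) e) (Finₚ.join-splitAt (suc h) (suc h) j)))

FourSquares-composite : ∀ {n} → (∀ {m} → m < n → FourSquares (+ m)) → Composite n → FourSquares (+ n)
FourSquares-composite {n} below c =
  subst FourSquares n≡qd (FourSquares-* (below (quotient-< divisor-∣)) (below divisor-<))
  where
  open _HasNonTrivialDivisorLessThan_ c
  instance _ = ℕ.>-nonZero (ℕₚ.m<n⇒0<n divisor-<)
  n≡qd : + quotient divisor-∣ * + divisor ≡ + n
  n≡qd = trans (sym (ℤₚ.pos-* (quotient divisor-∣) divisor)) (cong +_ (sym (_∣_.equality divisor-∣)))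

lagrange-four-squares : ∀ n → FourSquares (+ n)
lagrange-four-squares = <-rec _ byParity
  where
  byParity : ∀ n → (∀ {m} → m < n → FourSquares (+ m)) → FourSquares (+ n)
  byParity n below with parityℕ n
  ... | even zero    = + 0 , + 0 , + 0 , + 0 , refl
  ... | even (suc j) = subst FourSquares (sym (+[j+j]≡+2*+j (suc j)))
                         (FourSquares-* (+ 1 , + 1 , + 0 , + 0 , refl) (below (ℕₚ.m<m+n (suc j) (ℕ.s≤s ℕ.z≤n))))
  ... | odd zero     = + 1 , + 0 , + 0 , + 0 , refl
  ... | odd (suc h) with smallMultiple {suc h} (ℕ.s≤s ℕ.z≤n)
  ...   | inj₁ composite-n = FourSquares-composite below composite-n
  ...   | inj₂ (m , 0<m , m<n , rep) with descent m 0<m m<n rep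
  ...     | inj₁ composite-n = FourSquares-composite below composite-n
  ...     | inj₂ rep′ = rep′

-- In simple-root coordinates, witness a b c d = a α₅ + b α₇ + c ρ + d σ - α₃ with
-- ρ = (1,1,2,3,2,1,1,1) and σ = (1,1,2,3,3,3,2,1).  The roots α₃, α₅, α₇, ρ, σ are
-- mutually orthogonal, and α₁ is orthogonal to all of them except ⟨α₃ , α₁⟩ = -1.
witness : ℤ → ℤ → ℤ → ℤ → E8
witness a b c d = Vec.fromList
  (c + d ∷ c + d ∷ + 2 * (c + d) - + 1 ∷ + 3 * (c + d) ∷
   a + + 2 * c + + 3 * d ∷ c + + 3 * d ∷ b + c + + 2 * d ∷ c + d ∷ [])

α₁ : E8
α₁ = Vec.fromList (+ 1 ∷ + 0 ∷ + 0 ∷ + 0 ∷ + 0 ∷ + 0 ∷ + 0 ∷ + 0 ∷ [])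

_-ᵥ_ : E8 → E8 → E8
_-ᵥ_ = zipWith _-_

⟨_,_⟩ₚ : ∀ {k} → Vec (Polynomial k) 8 → Vec (Polynomial k) 8 → Polynomial k
⟨ v , w ⟩ₚ = Σₚ (tabulate λ i → lookup v i :*
                Σₚ (tabulate λ j → con (lookup (lookup CartanE8 i) j) :* lookup w j))
  where Σₚ = foldr _ _:+_ (con (+ 0))

witnessₚ : ∀ {k} → Polynomial k → Polynomial k → Polynomial k → Polynomial k → Vec (Polynomial k) 8
witnessₚ a b c d = Vec.fromList
  (c :+ d ∷ c :+ d ∷ con (+ 2) :* (c :+ d) :- con (+ 1) ∷ con (+ 3) :* (c :+ d) ∷
   a :+ con (+ 2) :* c :+ con (+ 3) :* d ∷ c :+ con (+ 3) :* d ∷ b :+ c :+ con (+ 2) :* d ∷ c :+ d ∷ [])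

witnessₚ-α₁ : ∀ {k} → Polynomial k → Polynomial k → Polynomial k → Polynomial k → Vec (Polynomial k) 8
witnessₚ-α₁ a b c d = zipWith _:-_ (witnessₚ a b c d) (Vec.map con α₁)

⟨witness,witness⟩ : ∀ a b c d → ⟨ witness a b c d , witness a b c d ⟩ ≡ + 2 + + 2 * sumOfSquares a b c d
⟨witness,witness⟩ = solve-polynomial 4 (λ a b c d →
  ⟨ witnessₚ a b c d , witnessₚ a b c d ⟩ₚ := con (+ 2) :+ con (+ 2) :* sumOfSquaresₚ a b c d) refl

⟨witness-α₁,witness-α₁⟩ : ∀ a b c d →
  ⟨ witness a b c d -ᵥ α₁ , witness a b c d -ᵥ α₁ ⟩ ≡ + 2 + + 2 * sumOfSquares a b c d
⟨witness-α₁,witness-α₁⟩ = solve-polynomial 4 (λ a b c d →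
  ⟨ witnessₚ-α₁ a b c d , witnessₚ-α₁ a b c d ⟩ₚ := con (+ 2) :+ con (+ 2) :* sumOfSquaresₚ a b c d) refl

⟨witness,witness-α₁⟩ : ∀ a b c d →
  ⟨ witness a b c d , witness a b c d -ᵥ α₁ ⟩ ≡ + 1 + + 2 * sumOfSquares a b c d
⟨witness,witness-α₁⟩ = solve-polynomial 4 (λ a b c d →
  ⟨ witnessₚ a b c d , witnessₚ-α₁ a b c d ⟩ₚ := con (+ 1) :+ con (+ 2) :* sumOfSquaresₚ a b c d) refl

2+2n≡2[1+n] : ∀ n → + 2 + + 2 * + n ≡ + (2 *ℕ suc n)
2+2n≡2[1+n] n = trans (factor (+ n)) (trans (cong (+ 2 *_) (sym (ℤₚ.pos-+ 1 n))) (sym (ℤₚ.pos-* 2 (suc n))))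
  where
  factor : ∀ x → + 2 + + 2 * x ≡ + 2 * (+ 1 + x)
  factor = solve-∀

lemma2p2 : (n : ℕ) → ∃₂ λ (v w : E8) →
    (⟨ v , v ⟩ ≡ + (2 *ℕ suc n)) ×
    (⟨ w , w ⟩ ≡ + (2 *ℕ suc n)) ×
    (⟨ v , w ⟩ ≡ + (2 *ℕ suc n) - + 1)
lemma2p2 n with lagrange-four-squares n
... | a , b , c , d , S≡n =
  witness a b c d , witness a b c d -ᵥ α₁ ,
  trans (⟨witness,witness⟩ a b c d) 2+2S≡2[1+n] ,
  trans (⟨witness-α₁,witness-α₁⟩ a b c d) 2+2S≡2[1+n] ,
  trans (⟨witness,witness-α₁⟩ a b c d) (trans (1+2s≡[2+2s]-1 (sumOfSquares a b c d)) (cong (_- + 1) 2+2S≡2[1+n]))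
  where
  2+2S≡2[1+n] : + 2 + + 2 * sumOfSquares a b c d ≡ + (2 *ℕ suc n)
  2+2S≡2[1+n] = trans (cong (λ s → + 2 + + 2 * s) S≡n) (2+2n≡2[1+n] n)
  1+2s≡[2+2s]-1 : ∀ s → + 1 + + 2 * s ≡ + 2 + + 2 * s - + 1
  1+2s≡[2+2s]-1 = solve-∀
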